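{- Let $G$ be a connected graph on $n$ vertices with $m$ edges, diameter $D$, maximum degree $\Delta$ and minimum degree $\delta$, and let $H,H'$ be connected graphs on the same vertex set. Let $\lambda=\lambda(G,H)$ and $\lambda'=\lambda(G,H')$. Then $$\lambda'\le \frac{\Delta^2}{\delta^2}(1+S_G)\,\lambda,\qquad S_G=\left(\binom{n}{2}-m\right)D^2.$$
   Context: All graphs are finite and simple. For a graph $G$, $d_v$ denotes the degree of $v$, $u\sim v$ means adjacency, and $\mathrm{vol}(G)=\sum_v d_v$. For a metric space $(X,d)$ and $f:V(G)\to X$ set $R_f(G,X)=\frac{\mathrm{vol}(G)\sum_{u\sim v} d(f(u),f(v))^2}{\sum_{u,v} d(f(u),f(v))^2 d_u d_v}$, where the numerator sum is over edges of $G$ and the denominator sum over unordered pairs of vertices; $\lambda(G,X)=\inf_f R_f(G,X)$ over all $f$ with nonzero denominator. A connected graph $H$ is regarded as the metric space $(V(H),d_H)$ with shortest-path distance, and $\lambda(G,H)=\lambda(G,(V(H),d_H))$. -}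

module Defs where

open import Data.Bool using (Bool; true; false; if_then_else_; _∧_; _∨_)
open import Data.Nat as ℕ using (ℕ; zero; suc; _+_; _*_; _∸_; _^_; _⊔_; _⊓_; _<ᵇ_; NonZero)
open import Data.Nat.Combinatorics using (_C_)
open import Data.Fin using (Fin; toℕ; _≟_)
open import Data.List using (List; tabulate; foldr)
open import Data.Nat.ListAction using (sum)
open import Data.Bool.ListAction using (any)
open import Data.Integer using (+_)
open import Data.Rational as ℚ using (ℚ; _/_)
open import Relation.Binary.PropositionalEquality using (_≡_)
open import Relation.Nullary.Decidable using (⌊_⌋)

record Graph (n : ℕ) : Set where
  field
    adj    : Fin n → Fin n → Bool
    sym    : ∀ u v → adj u v ≡ adj v u
    irrefl : ∀ u → adj u u ≡ false
open Graph public

data Walk {n : ℕ} (G : Graph n) : Fin n → Fin n → Set where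
  here : ∀ {u} → Walk G u u
  step : ∀ {u w v} → adj G u w ≡ true → Walk G w v → Walk G u v

Connected : {n : ℕ} → Graph n → Set
Connected G = ∀ u v → Walk G u v

-- Sums over vertices / ordered vertex pairs u < v (= unordered pairs of distinct vertices).
Σv : {n : ℕ} → (Fin n → ℕ) → ℕ
Σv f = sum (tabulate f)

Σpairs : {n : ℕ} → (Fin n → Fin n → ℕ) → ℕ
Σpairs {n} f = Σv λ u → Σv λ v → if toℕ u <ᵇ toℕ v then f u v else 0

b2n : Bool → ℕ
b2n true  = 1
b2n false = 0

deg : {n : ℕ} → Graph n → Fin n → ℕ
deg G v = Σv λ w → b2n (adj G v w)

vol : {n : ℕ} → Graph n → ℕ
vol G = Σv (deg G)

edges : {n : ℕ} → Graph n → ℕ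
edges G = Σpairs λ u v → b2n (adj G u v)

maxDeg : {n : ℕ} → Graph n → ℕ
maxDeg G = foldr _⊔_ 0 (tabulate (deg G))

-- minimum degree (the initial value n exceeds every degree, so for n ≥ 1 this is the minimum)
minDeg : {n : ℕ} → Graph n → ℕ
minDeg {n} G = foldr _⊓_ n (tabulate (deg G))

reach : {n : ℕ} → Graph n → ℕ → Fin n → Fin n → Bool
reach G zero    u v = ⌊ u ≟ v ⌋
reach G (suc k) u v = reach G k u v ∨ any (λ w → reach G k u w ∧ adj G w v) (tabulate (λ w → w))

distFrom : {n : ℕ} → Graph n → Fin n → Fin n → ℕ → ℕ → ℕ
distFrom G u v k zero       = k
distFrom G u v k (suc fuel) = if reach G k u v then k else distFrom G u v (suc k) fuel

dist : {n : ℕ} → Graph n → Fin n → Fin n → ℕ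
dist {n} G u v = distFrom G u v 0 n

diam : {n : ℕ} → Graph n → ℕ
diam G = foldr _⊔_ 0 (tabulate λ u → foldr _⊔_ 0 (tabulate λ v → dist G u v))

numer : {n k : ℕ} → Graph n → Graph k → (Fin n → Fin k) → ℕ
numer G H f = Σpairs λ u v → b2n (adj G u v) * dist H (f u) (f v) ^ 2

denom : {n k : ℕ} → Graph n → Graph k → (Fin n → Fin k) → ℕ
denom G H f = Σpairs λ u v → dist H (f u) (f v) ^ 2 * deg G u * deg G v

R : {n k : ℕ} (G : Graph n) (H : Graph k) (f : Fin n → Fin k) →
    .{{_ : NonZero (denom G H f)}} → ℚ
R G H f = (+ (vol G * numer G H f)) / denom G H f

-- λ(G,H) = inf of R_f over f with nonzero denominator: l is the greatest lower bound.
LowerBound : {n k : ℕ} → Graph n → Graph k → ℚ → Set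
LowerBound G H l = ∀ f → .{{_ : NonZero (denom G H f)}} → l ℚ.≤ R G H f

IsLambda : {n k : ℕ} → Graph n → Graph k → ℚ → Set
IsLambda G H l = LowerBound G H l × (∀ μ → LowerBound G H μ → μ ℚ.≤ l)
  where open import Data.Product using (_×_)

toℚ : ℕ → ℚ
toℚ m = (+ m) / 1

-- For any f, two vertices at G-distance j are sent to H-distance at most j √numer, by the
-- triangle inequality along a shortest walk.  Splitting the vertex pairs into the m edges and the
-- C(n,2) − m non-edges of G then gives δ² numer ≤ denom ≤ Δ² (1 + S_G) numer.  The upper bound
-- makes vol / (Δ² (1 + S_G)) a lower bound of every R_f into H, so vol ≤ Δ² (1 + S_G) λ; the lower
-- bound, applied to a two-valued map separating the ends of an edge, gives δ² λ′ ≤ vol.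
module Submission where

open import Defs
open import Data.Nat using (ℕ; _+_; _*_; _∸_; _^_)
open import Data.Nat.Combinatorics using (_C_)
open import Data.Rational as ℚ using (ℚ)

open import Data.Bool using (true; false; T; if_then_else_)
open import Data.Bool.Properties using (T?; T-≡; T-∨; T-∧)
import Data.Empty.Irrelevant as Irrelevant
open import Data.Fin using (Fin; toℕ; _≟_) renaming (zero to fzero; suc to fsuc)
open import Data.Fin.Properties using (any?; toℕ-injective)
import Data.Integer as ℤ
import Data.Integer.Properties as ℤ
open import Data.List using (tabulate; foldr)
open import Data.List.Relation.Unary.Any.Properties using (any⁺; any⁻; tabulate⁺; tabulate⁻)
open import Data.Nat
  using (zero; suc; _≤_; _<_; z≤n; s≤s; z<s; _⊔_; _⊓_; _<ᵇ_; NonZero; >-nonZero; ≢-nonZero⁻¹)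
open import Data.Nat.Combinatorics using (nC1≡n; nCk+nC[k+1]≡[n+1]C[k+1])
open import Data.Nat.Properties renaming (_≟_ to _≟ℕ_)
open import Algebra.Properties.CommutativeSemigroup +-commutativeSemigroup using (interchange)
open import Algebra.Properties.CommutativeSemigroup *-commutativeSemigroup using (xy∙z≈xz∙y)
open import Data.Nat.Solver using (module +-*-Solver)
open import Data.Product using (∃; ∃₂; _×_; _,_; proj₂)
import Data.Rational.Properties as ℚ
import Data.Rational.Unnormalised as ℚᵘ
import Data.Rational.Unnormalised.Properties as ℚᵘ
open import Data.Sum using (_⊎_; inj₁; inj₂)
open import Function using (_∘_; Equivalence)
open import Relation.Binary using (tri<; tri≈; tri>)
open import Relation.Binary.PropositionalEquality as ≡
  using (_≡_; _≢_; refl; trans; cong; cong₂; subst; subst₂; module ≡-Reasoning)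
open import Relation.Nullary using (¬_; Dec; yes; no; contradiction)
open import Relation.Nullary.Decidable using (toWitness; fromWitness; _×-dec_; ¬?)
open +-*-Solver
open Equivalence using (to; from)

b2n-mono : ∀ {x y} → (T x → T y) → b2n x ≤ b2n y
b2n-mono {false}         _   = z≤n
b2n-mono {true}  {false} x⇒y = contradiction _ x⇒y
b2n-mono {true}  {true}  _   = ≤-refl

b2n-mono-< : ∀ {x y} → ¬ T x → T y → b2n x < b2n y
b2n-mono-< {false} {true} _ _ = z<s
b2n-mono-< {true}         ¬x _ = contradiction _ ¬x

b2n≤1 : ∀ x → b2n x ≤ 1
b2n≤1 false = z≤n
b2n≤1 true  = ≤-refl

b2n>0⇒T : ∀ {x} → 0 < b2n x → T x
b2n>0⇒T {true} _ = _

Σv-cong : ∀ {n} (f g : Fin n → ℕ) → (∀ v → f v ≡ g v) → Σv f ≡ Σv g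
Σv-cong {zero}  f g f≡g = refl
Σv-cong {suc n} f g f≡g = cong₂ _+_ (f≡g fzero) (Σv-cong (f ∘ fsuc) (g ∘ fsuc) (f≡g ∘ fsuc))

Σv-mono : ∀ {n} (f g : Fin n → ℕ) → (∀ v → f v ≤ g v) → Σv f ≤ Σv g
Σv-mono {zero}  f g f≤g = z≤n
Σv-mono {suc n} f g f≤g = +-mono-≤ (f≤g fzero) (Σv-mono (f ∘ fsuc) (g ∘ fsuc) (f≤g ∘ fsuc))

Σv-mono-< : ∀ {n} (f g : Fin n → ℕ) → (∀ v → f v ≤ g v) → ∀ x → f x < g x → Σv f < Σv g
Σv-mono-< {suc n} f g f≤g fzero    fx<gx =
  +-mono-<-≤ fx<gx (Σv-mono (f ∘ fsuc) (g ∘ fsuc) (f≤g ∘ fsuc))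
Σv-mono-< {suc n} f g f≤g (fsuc x) fx<gx =
  +-mono-≤-< (f≤g fzero) (Σv-mono-< (f ∘ fsuc) (g ∘ fsuc) (f≤g ∘ fsuc) x fx<gx)

Σv-+ : ∀ {n} (f g : Fin n → ℕ) → Σv (λ v → f v + g v) ≡ Σv f + Σv g
Σv-+ {zero}  f g = refl
Σv-+ {suc n} f g = begin
  f fzero + g fzero + Σv (λ v → f (fsuc v) + g (fsuc v))
    ≡⟨ cong ((f fzero + g fzero) +_) (Σv-+ (f ∘ fsuc) (g ∘ fsuc)) ⟩
  f fzero + g fzero + (Σv (f ∘ fsuc) + Σv (g ∘ fsuc))
    ≡⟨ interchange (f fzero) (g fzero) (Σv (f ∘ fsuc)) (Σv (g ∘ fsuc)) ⟩
  f fzero + Σv (f ∘ fsuc) + (g fzero + Σv (g ∘ fsuc)) ∎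
  where
  open ≡-Reasoning

Σv-*ˡ : ∀ {n} c (f : Fin n → ℕ) → Σv (λ v → c * f v) ≡ c * Σv f
Σv-*ˡ {zero}  c f = ≡.sym (*-zeroʳ c)
Σv-*ˡ {suc n} c f = trans (cong ((c * f fzero) +_) (Σv-*ˡ c (f ∘ fsuc))) (≡.sym (*-distribˡ-+ c _ _))

Σv-one : ∀ n → Σv {n} (λ _ → 1) ≡ n
Σv-one zero    = refl
Σv-one (suc n) = cong suc (Σv-one n)

term≤Σv : ∀ {n} (f : Fin n → ℕ) x → f x ≤ Σv f
term≤Σv f fzero    = m≤m+n _ _
term≤Σv f (fsuc x) = ≤-trans (term≤Σv (f ∘ fsuc) x) (m≤n+m _ (f fzero))

Σv-pos⇒pos-term : ∀ {n} (f : Fin n → ℕ) → 0 < Σv f → ∃ λ x → 0 < f x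
Σv-pos⇒pos-term {suc n} f pos with f fzero in eq
... | suc _ = fzero , subst (0 <_) (≡.sym eq) z<s
... | zero  with Σv-pos⇒pos-term (f ∘ fsuc) pos
...   | x , fx>0 = fsuc x , fx>0

private
  aboveDiagonal : ∀ {n} → (Fin n → Fin n → ℕ) → Fin n → Fin n → ℕ
  aboveDiagonal F u v = if toℕ u <ᵇ toℕ v then F u v else 0

Σpairs-cong : ∀ {n} (F F′ : Fin n → Fin n → ℕ) → (∀ u v → F u v ≡ F′ u v) → Σpairs F ≡ Σpairs F′
Σpairs-cong F F′ F≡F′ =
  Σv-cong _ _ λ u → Σv-cong _ _ λ v → cong (if toℕ u <ᵇ toℕ v then_else 0) (F≡F′ u v)

Σpairs-mono : ∀ {n} (F F′ : Fin n → Fin n → ℕ) → (∀ u v → F u v ≤ F′ u v) → Σpairs F ≤ Σpairs F′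
Σpairs-mono F F′ F≤F′ = Σv-mono _ _ λ u → Σv-mono _ _ λ v → if-mono (toℕ u <ᵇ toℕ v) (F≤F′ u v)
  where
  if-mono : ∀ b {x y} → x ≤ y → (if b then x else 0) ≤ (if b then y else 0)
  if-mono true  x≤y = x≤y
  if-mono false _   = z≤n

Σpairs-+ : ∀ {n} (F F′ : Fin n → Fin n → ℕ) → Σpairs (λ u v → F u v + F′ u v) ≡ Σpairs F + Σpairs F′
Σpairs-+ F F′ = trans
  (Σv-cong _ (λ u → Σv (aboveDiagonal F u) + Σv (aboveDiagonal F′ u)) λ u →
    trans (Σv-cong _ (λ v → aboveDiagonal F u v + aboveDiagonal F′ u v) λ v → if-+ (toℕ u <ᵇ toℕ v))
          (Σv-+ (aboveDiagonal F u) (aboveDiagonal F′ u)))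
  (Σv-+ (λ u → Σv (aboveDiagonal F u)) (λ u → Σv (aboveDiagonal F′ u)))
  where
  if-+ : ∀ b {x y} → (if b then x + y else 0) ≡ (if b then x else 0) + (if b then y else 0)
  if-+ true  = refl
  if-+ false = refl

Σpairs-*ˡ : ∀ {n} c (F : Fin n → Fin n → ℕ) → Σpairs (λ u v → c * F u v) ≡ c * Σpairs F
Σpairs-*ˡ c F = trans
  (Σv-cong _ (λ u → c * Σv (aboveDiagonal F u)) λ u →
    trans (Σv-cong _ (λ v → c * aboveDiagonal F u v) λ v → if-* (toℕ u <ᵇ toℕ v))
          (Σv-*ˡ c (aboveDiagonal F u)))
  (Σv-*ˡ c (λ u → Σv (aboveDiagonal F u)))
  where
  if-* : ∀ b {x} → (if b then c * x else 0) ≡ c * (if b then x else 0)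
  if-* true  = refl
  if-* false = ≡.sym (*-zeroʳ c)

Σpairs-one : ∀ n → Σpairs {n} (λ _ _ → 1) ≡ n C 2
Σpairs-one zero    = refl
Σpairs-one (suc n) = begin
  Σv {n} (λ _ → 1) + Σpairs {n} (λ _ _ → 1) ≡⟨ cong₂ _+_ (Σv-one n) (Σpairs-one n) ⟩
  n + n C 2                                 ≡⟨ cong (_+ n C 2) (≡.sym (nC1≡n n)) ⟩
  n C 1 + n C 2                             ≡⟨ nCk+nC[k+1]≡[n+1]C[k+1] n 1 ⟩
  suc n C 2                                 ∎
  where open ≡-Reasoning

ordered-term≤Σpairs : ∀ {n} (F : Fin n → Fin n → ℕ) {u v} → toℕ u < toℕ v → F u v ≤ Σpairs F
ordered-term≤Σpairs F {u} {v} u<v =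
  ≤-trans (≤-reflexive (cong (if_then F u v else 0) (≡.sym (to T-≡ (<⇒<ᵇ u<v)))))
  (≤-trans (term≤Σv (aboveDiagonal F u) v) (term≤Σv (λ x → Σv (aboveDiagonal F x)) u))

term≤Σpairs : ∀ {n} (F : Fin n → Fin n → ℕ) → (∀ u v → F u v ≡ F v u) →
              ∀ {u v} → u ≢ v → F u v ≤ Σpairs F
term≤Σpairs F F-sym {u} {v} u≢v with <-cmp (toℕ u) (toℕ v)
... | tri< u<v _ _ = ordered-term≤Σpairs F u<v
... | tri≈ _ u≡v _ = contradiction (toℕ-injective u≡v) u≢v
... | tri> _ _ v<u = subst (_≤ Σpairs F) (F-sym v u) (ordered-term≤Σpairs F v<u)

≤-maximum : ∀ {n} (g : Fin n → ℕ) x → g x ≤ foldr _⊔_ 0 (tabulate g)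
≤-maximum g fzero    = m≤m⊔n _ _
≤-maximum g (fsuc x) = ≤-trans (≤-maximum (g ∘ fsuc) x) (m≤n⊔m (g fzero) _)

minimum-≤ : ∀ {n} c (g : Fin n → ℕ) x → foldr _⊓_ c (tabulate g) ≤ g x
minimum-≤ c g fzero    = m⊓n≤m _ _
minimum-≤ c g (fsuc x) = ≤-trans (m⊓n≤n (g fzero) _) (minimum-≤ c (g ∘ fsuc) x)

deg≤maxDeg : ∀ {n} (G : Graph n) v → deg G v ≤ maxDeg G
deg≤maxDeg G = ≤-maximum (deg G)

minDeg≤deg : ∀ {n} (G : Graph n) v → minDeg G ≤ deg G v
minDeg≤deg {n} G = minimum-≤ n (deg G)

-- A record, unlike T (reach G j u v), determines j, u and v, so they can be left implicit.
record Reach {n : ℕ} (G : Graph n) (j : ℕ) (u v : Fin n) : Set where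
  constructor reached
  field reached⁻ : T (reach G j u v)
open Reach

module _ {n : ℕ} (G : Graph n) where

  reach-zero⁻ : ∀ {u v} → Reach G 0 u v → u ≡ v
  reach-zero⁻ (reached r) = toWitness r

  reach-refl : ∀ j u → Reach G j u u
  reach-refl zero    u = reached (fromWitness refl)
  reach-refl (suc j) u = reached (from T-∨ (inj₁ (reached⁻ (reach-refl j u))))

  reach-suc⁺ : ∀ {j u v} → Reach G j u v → Reach G (suc j) u v
  reach-suc⁺ (reached r) = reached (from T-∨ (inj₁ r))

  reach-step : ∀ {j u w v} → Reach G j u w → T (adj G w v) → Reach G (suc j) u v
  reach-step {w = w} (reached r) a = reached (from T-∨ (inj₂ (any⁺ _ (tabulate⁺ w (from T-∧ (r , a))))))

  reach-suc⁻ : ∀ {j u v} → Reach G (suc j) u v →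
               Reach G j u v ⊎ ∃ λ w → Reach G j u w × T (adj G w v)
  reach-suc⁻ (reached r) with to T-∨ r
  ... | inj₁ r′ = inj₁ (reached r′)
  ... | inj₂ r′ with tabulate⁻ (any⁻ _ _ r′)
  ...   | w , rw with to T-∧ rw
  ...     | r″ , a = inj₂ (w , reached r″ , a)

  reach-adj : ∀ {u v} → T (adj G u v) → Reach G 1 u v
  reach-adj {u} = reach-step (reach-refl 0 u)

  reach-trans : ∀ {i j u v w} → Reach G i u v → Reach G j v w → Reach G (i + j) u w
  reach-trans {i} {zero} r r′ with refl ← reach-zero⁻ r′ =
    subst (λ k → Reach G k _ _) (≡.sym (+-identityʳ i)) r
  reach-trans {i} {suc j} r r′ rewrite +-suc i j with reach-suc⁻ r′
  ... | inj₁ r″           = reach-suc⁺ (reach-trans r r″)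
  ... | inj₂ (_ , r″ , a) = reach-step (reach-trans r r″) a

  reach-mono : ∀ {i j u v} → i ≤ j → Reach G i u v → Reach G j u v
  reach-mono {i} {j} {v = v} i≤j r =
    subst (λ k → Reach G k _ _) (m+[n∸m]≡n i≤j) (reach-trans r (reach-refl (j ∸ i) v))

  reach-sym : ∀ {j u v} → Reach G j u v → Reach G j v u
  reach-sym {zero} r with refl ← reach-zero⁻ r = r
  reach-sym {suc j} r with reach-suc⁻ r
  ... | inj₁ r′           = reach-suc⁺ (reach-sym r′)
  ... | inj₂ (_ , r′ , a) = reach-trans (reach-adj (subst T (sym G _ _) a)) (reach-sym r′)

  walk⇒reach : ∀ {u v} → Walk G u v → ∃ λ L → Reach G L u v
  walk⇒reach {u} here = 0 , reach-refl 0 u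
  walk⇒reach (step a w) with walk⇒reach w
  ... | L , r = suc L , reach-trans (reach-adj (from T-≡ a)) r

  Saturated : Fin n → ℕ → Set
  Saturated u k = ∀ {v} → Reach G (suc k) u v → Reach G k u v

  saturated-suc : ∀ {u k} → Saturated u k → Saturated u (suc k)
  saturated-suc sat r with reach-suc⁻ r
  ... | inj₁ r′           = r′
  ... | inj₂ (_ , r′ , a) = reach-step (sat r′) a

  saturated-+ : ∀ {u k} j → Saturated u k → Saturated u (j + k)
  saturated-+ zero    sat = sat
  saturated-+ (suc j) sat = saturated-suc (saturated-+ j sat)

  saturated-collapse : ∀ {u k} → Saturated u k → ∀ j {v} → Reach G (j + k) u v → Reach G k u v
  saturated-collapse sat zero    r = r
  saturated-collapse sat (suc j) r = saturated-collapse sat j (saturated-+ j sat r)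

  reachCount : Fin n → ℕ → ℕ
  reachCount u k = Σv λ v → b2n (reach G k u v)

  reachCount≤n : ∀ u k → reachCount u k ≤ n
  reachCount≤n u k = ≤-trans (Σv-mono _ (λ _ → 1) λ v → b2n≤1 (reach G k u v)) (≤-reflexive (Σv-one n))

  saturated-or-growing : ∀ u k → Saturated u k ⊎ reachCount u k < reachCount u (suc k)
  saturated-or-growing u k with any? (λ v → T? (reach G (suc k) u v) ×-dec ¬? (T? (reach G k u v)))
  ... | yes (v , new , ¬old) = inj₂ (Σv-mono-< _ _ grows v (b2n-mono-< ¬old new))
    where
    grows : ∀ w → b2n (reach G k u w) ≤ b2n (reach G (suc k) u w)
    grows w = b2n-mono (reached⁻ ∘ reach-suc⁺ ∘ reached {j = k} {u} {w})
  ... | no nothing-new = inj₁ λ {v} (reached r) → reached (old v r)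
    where
    old : ∀ v → T (reach G (suc k) u v) → T (reach G k u v)
    old v r with T? (reach G k u v)
    ... | yes r′  = r′
    ... | no ¬r′ = contradiction (v , r , ¬r′) nothing-new

  -- Walks of length ≥ n reach nothing new: until the set of vertices reachable within k steps
  -- saturates, it has more than k elements, and it never has more than n.
  saturated-or-counting : ∀ u k → (∃ λ j → j < k × Saturated u j) ⊎ k < reachCount u k
  saturated-or-counting u zero =
    inj₂ (≤-trans (b2n-mono {true} λ _ → reached⁻ (reach-refl 0 u)) (term≤Σv _ u))
  saturated-or-counting u (suc k) with saturated-or-counting u k
  ... | inj₁ (j , j<k , sat) = inj₁ (j , m<n⇒m<1+n j<k , sat)
  ... | inj₂ k<count with saturated-or-growing u k
  ...   | inj₁ sat    = inj₁ (k , n<1+n k , sat)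
  ...   | inj₂ growth = inj₂ (<-≤-trans (s≤s k<count) growth)

  saturates-below-n : ∀ u → ∃ λ k → k < n × Saturated u k
  saturates-below-n u with saturated-or-counting u n
  ... | inj₁ found   = found
  ... | inj₂ n<count = contradiction (reachCount≤n u n) (<⇒≱ n<count)

  reach-below-n : ∀ {L u v} → Reach G L u v → ∃ λ j → j < n × Reach G j u v
  reach-below-n {L} {u} r with saturates-below-n u
  ... | k , k<n , sat with ≤-total L k
  ...   | inj₁ L≤k = k , k<n , reach-mono L≤k r
  ...   | inj₂ k≤L =
    k , k<n , saturated-collapse sat (L ∸ k) (subst (λ i → Reach G i _ _) (≡.sym (m∸n+n≡m k≤L)) r)

  distFrom-≤ : ∀ {u v} k fuel → distFrom G u v k fuel ≤ k + fuel
  distFrom-≤ k zero = ≤-reflexive (≡.sym (+-identityʳ k))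
  distFrom-≤ {u} {v} k (suc fuel) with reach G k u v
  ... | true  = m≤m+n k (suc fuel)
  ... | false = ≤-trans (distFrom-≤ (suc k) fuel) (≤-reflexive (≡.sym (+-suc k fuel)))

  distFrom-exhausted-or-reaches : ∀ {u v} k fuel →
    distFrom G u v k fuel ≡ k + fuel ⊎ Reach G (distFrom G u v k fuel) u v
  distFrom-exhausted-or-reaches k zero = inj₁ (≡.sym (+-identityʳ k))
  distFrom-exhausted-or-reaches {u} {v} k (suc fuel) with reach G k u v in eq
  ... | true  = inj₂ (reached (from T-≡ eq))
  ... | false with distFrom-exhausted-or-reaches (suc k) fuel
  ...   | inj₁ exhausted = inj₁ (trans exhausted (≡.sym (+-suc k fuel)))
  ...   | inj₂ r         = inj₂ r

  distFrom-least : ∀ {u v t} k fuel → Reach G t u v → k ≤ t → distFrom G u v k fuel ≤ t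
  distFrom-least k zero r k≤t = k≤t
  distFrom-least {u} {v} {t} k (suc fuel) r k≤t with reach G k u v in eq
  ... | true  = k≤t
  ... | false = distFrom-least (suc k) fuel r (≤∧≢⇒< k≤t k≢t)
    where
    k≢t : k ≢ t
    k≢t refl = subst T eq (reached⁻ r)

  dist≤n : ∀ u v → dist G u v ≤ n
  dist≤n u v = distFrom-≤ 0 n

  dist-exhausted-or-reaches : ∀ u v → dist G u v ≡ n ⊎ Reach G (dist G u v) u v
  dist-exhausted-or-reaches u v = distFrom-exhausted-or-reaches 0 n

  dist-least : ∀ {t u v} → Reach G t u v → dist G u v ≤ t
  dist-least r = distFrom-least 0 n r z≤n

  dist-refl : ∀ u → dist G u u ≡ 0
  dist-refl u = n≤0⇒n≡0 (dist-least (reach-refl 0 u))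

  dist≡0⇒≡ : ∀ u v → dist G u v ≡ 0 → u ≡ v
  dist≡0⇒≡ u v d≡0 with dist-exhausted-or-reaches u v
  ... | inj₂ r         = reach-zero⁻ (subst (λ k → Reach G k u v) d≡0 r)
  ... | inj₁ exhausted with () ← subst Fin (trans (≡.sym exhausted) d≡0) u

  dist-sym-≤ : ∀ u v → dist G u v ≤ dist G v u
  dist-sym-≤ u v with dist-exhausted-or-reaches v u
  ... | inj₁ exhausted = subst (dist G u v ≤_) (≡.sym exhausted) (dist≤n u v)
  ... | inj₂ r         = dist-least (reach-sym r)

  dist-sym : ∀ u v → dist G u v ≡ dist G v u
  dist-sym u v = ≤-antisym (dist-sym-≤ u v) (dist-sym-≤ v u)

  dist-triangle : ∀ u v w → dist G u w ≤ dist G u v + dist G v w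
  dist-triangle u v w with dist-exhausted-or-reaches u v | dist-exhausted-or-reaches v w
  ... | inj₁ exhausted | _ =
    ≤-trans (dist≤n u w) (≤-trans (≤-reflexive (≡.sym exhausted)) (m≤m+n _ _))
  ... | inj₂ _ | inj₁ exhausted =
    ≤-trans (dist≤n u w) (≤-trans (≤-reflexive (≡.sym exhausted)) (m≤n+m _ _))
  ... | inj₂ r | inj₂ r′ = dist-least (reach-trans r r′)

  dist-reaches : Connected G → ∀ u v → Reach G (dist G u v) u v
  dist-reaches connected u v
    with dist-exhausted-or-reaches u v | reach-below-n (proj₂ (walk⇒reach (connected u v)))
  ... | inj₂ r         | _           = r
  ... | inj₁ exhausted | j , j<n , r =
    contradiction (subst (_≤ j) exhausted (dist-least r)) (<⇒≱ j<n)

  dist≤diam : ∀ u v → dist G u v ≤ diam G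
  dist≤diam u v =
    ≤-trans (≤-maximum (dist G u) v) (≤-maximum (λ x → foldr _⊔_ 0 (tabulate (dist G x))) u)

adj⇒≢ : ∀ {n} (G : Graph n) {u v} → T (adj G u v) → u ≢ v
adj⇒≢ G {u} a refl = subst T (irrefl G u) a

^2-cancel-≤ : ∀ {a b} → a ^ 2 ≤ b ^ 2 → a ≤ b
^2-cancel-≤ a²≤b² = ≮⇒≥ λ b<a → <⇒≱ (^-monoˡ-< 2 b<a) a²≤b²

-- x + y ≤ (j + 1)√e without square roots: the cross term is bounded through (x y)² ≤ (j e)².
square-of-sum-≤ : ∀ x y j e → x ^ 2 ≤ j ^ 2 * e → y ^ 2 ≤ e → (x + y) ^ 2 ≤ suc j ^ 2 * e
square-of-sum-≤ x y j e x²≤j²e y²≤e = begin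
  (x + y) ^ 2
    ≡⟨ solve 2 (λ x y → (x :+ y) :^ 2 := x :^ 2 :+ con 2 :* (x :* y) :+ y :^ 2) refl x y ⟩
  x ^ 2 + 2 * (x * y) + y ^ 2
    ≤⟨ +-mono-≤ (+-mono-≤ x²≤j²e (*-monoʳ-≤ 2 xy≤je)) y²≤e ⟩
  j ^ 2 * e + 2 * (j * e) + e
    ≡⟨ solve 2 (λ j e → j :^ 2 :* e :+ con 2 :* (j :* e) :+ e := (con 1 :+ j) :^ 2 :* e) refl j e ⟩
  suc j ^ 2 * e
    ∎
  where
  open ≤-Reasoning
  xy≤je : x * y ≤ j * e
  xy≤je = ^2-cancel-≤ (begin
    (x * y) ^ 2     ≡⟨ solve 2 (λ x y → (x :* y) :^ 2 := x :^ 2 :* y :^ 2) refl x y ⟩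
    x ^ 2 * y ^ 2   ≤⟨ *-mono-≤ x²≤j²e y²≤e ⟩
    j ^ 2 * e * e   ≡⟨ solve 2 (λ j e → j :^ 2 :* e :* e := (j :* e) :^ 2) refl j e ⟩
    (j * e) ^ 2     ∎)

S : ∀ {n} → Graph n → ℕ
S {n} G = (n C 2 ∸ edges G) * diam G ^ 2

nonEdges : ∀ {n} (G : Graph n) → Σpairs (λ u v → 1 ∸ b2n (adj G u v)) ≡ n C 2 ∸ edges G
nonEdges {n} G = begin
  Σpairs nonAdj                                ≡⟨ ≡.sym (m+n∸n≡m (Σpairs nonAdj) (edges G)) ⟩
  Σpairs nonAdj + edges G ∸ edges G            ≡⟨ cong (_∸ edges G) (≡.sym (Σpairs-+ nonAdj _)) ⟩
  Σpairs (λ u v → nonAdj u v + b2n (adj G u v)) ∸ edges G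
    ≡⟨ cong (_∸ edges G) (Σpairs-cong _ _ λ u v → complement (adj G u v)) ⟩
  Σpairs {n} (λ _ _ → 1) ∸ edges G             ≡⟨ cong (_∸ edges G) (Σpairs-one n) ⟩
  n C 2 ∸ edges G                              ∎
  where
  open ≡-Reasoning
  nonAdj : Fin n → Fin n → ℕ
  nonAdj u v = 1 ∸ b2n (adj G u v)
  complement : ∀ b → 1 ∸ b2n b + b2n b ≡ 1
  complement true  = refl
  complement false = refl

Σpairs-≤-edges+nonEdges : ∀ {n} (G : Graph n) (F : Fin n → Fin n → ℕ) M → (∀ u v → F u v ≤ M) →
  Σpairs F ≤ Σpairs (λ u v → b2n (adj G u v) * F u v) + M * (n C 2 ∸ edges G)
Σpairs-≤-edges+nonEdges {n} G F M F≤M = begin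
  Σpairs F
    ≤⟨ Σpairs-mono _ _ (λ u v → split (adj G u v) (F≤M u v)) ⟩
  Σpairs (λ u v → b2n (adj G u v) * F u v + M * (1 ∸ b2n (adj G u v)))
    ≡⟨ Σpairs-+ (λ u v → b2n (adj G u v) * F u v) (λ u v → M * nonAdj u v) ⟩
  Σpairs (λ u v → b2n (adj G u v) * F u v) + Σpairs (λ u v → M * nonAdj u v)
    ≡⟨ cong (Σpairs (λ u v → b2n (adj G u v) * F u v) +_)
            (trans (Σpairs-*ˡ M nonAdj) (cong (M *_) (nonEdges G))) ⟩
  Σpairs (λ u v → b2n (adj G u v) * F u v) + M * (n C 2 ∸ edges G)
    ∎
  where
  open ≤-Reasoning
  nonAdj : Fin n → Fin n → ℕ
  nonAdj u v = 1 ∸ b2n (adj G u v)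
  split : ∀ b {x} → x ≤ M → x ≤ b2n b * x + M * (1 ∸ b2n b)
  split true  {x} _   = ≤-reflexive (solve 2 (λ x M → x := con 1 :* x :+ M :* con 0) refl x M)
  split false {x} x≤M = ≤-trans x≤M (≤-reflexive (solve 1 (λ M → M := con 0 :+ M :* con 1) refl M))

module _ {n k : ℕ} (G : Graph n) (H : Graph k) (f : Fin n → Fin k) where

  edge-dist²≤numer : ∀ {u v} → T (adj G u v) → dist H (f u) (f v) ^ 2 ≤ numer G H f
  edge-dist²≤numer {u} {v} a =
    ≤-trans (≤-reflexive (trans (≡.sym (*-identityˡ _)) (cong (λ b → b2n b * _) (≡.sym (to T-≡ a)))))
            (term≤Σpairs F F-sym (adj⇒≢ G a))
    where
    F : Fin n → Fin n → ℕ
    F x y = b2n (adj G x y) * dist H (f x) (f y) ^ 2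
    F-sym : ∀ x y → F x y ≡ F y x
    F-sym x y = cong₂ (λ b d → b2n b * d ^ 2) (sym G x y) (dist-sym H (f x) (f y))

  reach⇒dist²≤ : ∀ j {u v} → Reach G j u v → dist H (f u) (f v) ^ 2 ≤ j ^ 2 * numer G H f
  reach⇒dist²≤ zero {u} r with refl ← reach-zero⁻ G r rewrite dist-refl H (f u) = z≤n
  reach⇒dist²≤ (suc j) {u} {v} r with reach-suc⁻ G r
  ... | inj₁ r′ = ≤-trans (reach⇒dist²≤ j r′) (*-monoˡ-≤ (numer G H f) (^-monoˡ-≤ 2 (n≤1+n j)))
  ... | inj₂ (w , r′ , a) = ≤-trans (^-monoˡ-≤ 2 (dist-triangle H (f u) (f w) (f v)))
    (square-of-sum-≤ (dist H (f u) (f w)) (dist H (f w) (f v)) j (numer G H f)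
                     (reach⇒dist²≤ j r′) (edge-dist²≤numer a))

  dist²≤diam²*numer : Connected G → ∀ u v → dist H (f u) (f v) ^ 2 ≤ diam G ^ 2 * numer G H f
  dist²≤diam²*numer connected u v = ≤-trans (reach⇒dist²≤ _ (dist-reaches G connected u v))
    (*-monoˡ-≤ (numer G H f) (^-monoˡ-≤ 2 (dist≤diam G u v)))

  Σpairs-dist²≤ : Connected G → Σpairs (λ u v → dist H (f u) (f v) ^ 2) ≤ (1 + S G) * numer G H f
  Σpairs-dist²≤ connected = ≤-trans
    (Σpairs-≤-edges+nonEdges G _ _ (dist²≤diam²*numer connected))
    (≤-reflexive (solve 3 (λ E D² s → E :+ D² :* E :* s := (con 1 :+ s :* D²) :* E) refl
                   (numer G H f) (diam G ^ 2) (n C 2 ∸ edges G)))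

  denom≤maxDeg²[1+S]*numer : Connected G → denom G H f ≤ maxDeg G ^ 2 * (1 + S G) * numer G H f
  denom≤maxDeg²[1+S]*numer connected = begin
    denom G H f
      ≤⟨ Σpairs-mono _ _ (λ u v → *-mono-≤ (*-monoʳ-≤ (d u v ^ 2) (deg≤maxDeg G u)) (deg≤maxDeg G v)) ⟩
    Σpairs (λ u v → d u v ^ 2 * Δ * Δ)
      ≡⟨ Σpairs-cong _ _ (λ u v → solve 2 (λ x Δ → x :* Δ :* Δ := Δ :^ 2 :* x) refl (d u v ^ 2) Δ) ⟩
    Σpairs (λ u v → Δ ^ 2 * d u v ^ 2)
      ≡⟨ Σpairs-*ˡ (Δ ^ 2) (λ u v → d u v ^ 2) ⟩
    Δ ^ 2 * Σpairs (λ u v → d u v ^ 2)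
      ≤⟨ *-monoʳ-≤ (Δ ^ 2) (Σpairs-dist²≤ connected) ⟩
    Δ ^ 2 * ((1 + S G) * numer G H f)
      ≡⟨ ≡.sym (*-assoc (Δ ^ 2) (1 + S G) (numer G H f)) ⟩
    Δ ^ 2 * (1 + S G) * numer G H f
      ∎
    where
    open ≤-Reasoning
    Δ = maxDeg G
    d : Fin n → Fin n → ℕ
    d u v = dist H (f u) (f v)

  minDeg²*numer≤denom : minDeg G ^ 2 * numer G H f ≤ denom G H f
  minDeg²*numer≤denom = begin
    δ ^ 2 * numer G H f
      ≡⟨ ≡.sym (Σpairs-*ˡ (δ ^ 2) λ u v → b2n (adj G u v) * d u v ^ 2) ⟩
    Σpairs (λ u v → δ ^ 2 * (b2n (adj G u v) * d u v ^ 2))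
      ≤⟨ Σpairs-mono _ _ (λ u v → term≤ (adj G u v) u v) ⟩
    denom G H f
      ∎
    where
    open ≤-Reasoning
    δ = minDeg G
    d : Fin n → Fin n → ℕ
    d u v = dist H (f u) (f v)
    term≤ : ∀ b u v → δ ^ 2 * (b2n b * d u v ^ 2) ≤ d u v ^ 2 * deg G u * deg G v
    term≤ false u v = ≤-trans (≤-reflexive (*-zeroʳ (δ ^ 2))) z≤n
    term≤ true  u v =
      ≤-trans (≤-reflexive (solve 2 (λ δ x → δ :^ 2 :* (con 1 :* x) := x :* δ :* δ) refl δ (d u v ^ 2)))
              (*-mono-≤ (*-monoʳ-≤ (d u v ^ 2) (minDeg≤deg G u)) (minDeg≤deg G v))

toℚᵘ-frac : ∀ a b → ℚ.toℚᵘ ((ℤ.+ a) ℚ./ suc b) ℚᵘ.≃ ℚᵘ.mkℚᵘ (ℤ.+ a) b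
toℚᵘ-frac a b = ℚ.toℚᵘ-fromℚᵘ (ℚᵘ.mkℚᵘ (ℤ.+ a) b)

frac-≤ : ∀ a b c d .{{_ : NonZero b}} .{{_ : NonZero d}} →
         a * d ≤ c * b → (ℤ.+ a) ℚ./ b ℚ.≤ (ℤ.+ c) ℚ./ d
frac-≤ a (suc b) c (suc d) ad≤cb = ℚ.toℚᵘ-cancel-≤
  (ℚᵘ.≤-respˡ-≃ (ℚᵘ.≃-sym (toℚᵘ-frac a b))
    (ℚᵘ.≤-respʳ-≃ (ℚᵘ.≃-sym (toℚᵘ-frac c d)) (ℚᵘ.*≤* ad≤cb′)))
  where
  ad≤cb′ : ℤ.+ a ℤ.* ℤ.+ suc d ℤ.≤ ℤ.+ c ℤ.* ℤ.+ suc b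
  ad≤cb′ = subst₂ ℤ._≤_ (ℤ.pos-* a (suc d)) (ℤ.pos-* c (suc b)) (ℤ.+≤+ ad≤cb)

toℚ-*-frac : ∀ x a b .{{_ : NonZero b}} → toℚ x ℚ.* ((ℤ.+ a) ℚ./ b) ≡ (ℤ.+ (x * a)) ℚ./ b
toℚ-*-frac x a (suc b) = ℚ.toℚᵘ-injective (begin
  ℚ.toℚᵘ (toℚ x ℚ.* ((ℤ.+ a) ℚ./ suc b))
    ≈⟨ ℚ.toℚᵘ-homo-* (toℚ x) ((ℤ.+ a) ℚ./ suc b) ⟩
  ℚ.toℚᵘ (toℚ x) ℚᵘ.* ℚ.toℚᵘ ((ℤ.+ a) ℚ./ suc b)
    ≈⟨ ℚᵘ.*-cong (toℚᵘ-frac x 0) (toℚᵘ-frac a b) ⟩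
  ℚᵘ.mkℚᵘ (ℤ.+ x) 0 ℚᵘ.* ℚᵘ.mkℚᵘ (ℤ.+ a) b
    ≈⟨ ℚᵘ.*≡* (cong₂ ℤ._*_ (≡.sym (ℤ.pos-* x a)) (cong (λ z → ℤ.+ suc z) (≡.sym (+-identityʳ b)))) ⟩
  ℚᵘ.mkℚᵘ (ℤ.+ (x * a)) b
    ≈⟨ ℚᵘ.≃-sym (toℚᵘ-frac (x * a) b) ⟩
  ℚ.toℚᵘ ((ℤ.+ (x * a)) ℚ./ suc b)
    ∎)
  where open ℚᵘ.≃-Reasoning

toℚ-nonNeg : ∀ x → ℚ.NonNegative (toℚ x)
toℚ-nonNeg x = ℚ.nonNegative (frac-≤ 0 1 x 1 z≤n)

module _ {n k : ℕ} (G : Graph n) (H : Graph k) where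

  -- With no admissible f every rational is a lower bound, so there is no greatest one.
  denom≡0⇒¬IsLambda : (∀ f → denom G H f ≡ 0) → ∀ {l} → ¬ IsLambda G H l
  denom≡0⇒¬IsLambda denom≡0 {l} (_ , greatest) =
    ℚ.<-irrefl refl (ℚ.<-≤-trans l<l+1 (greatest (l ℚ.+ ℚ.1ℚ) vacuous))
    where
    vacuous : ∀ {μ} → LowerBound G H μ
    vacuous f {{denom≢0}} = Irrelevant.⊥-elim (≢-nonZero⁻¹ (denom G H f) {{denom≢0}} (denom≡0 f))
    l<l+1 : l ℚ.< l ℚ.+ ℚ.1ℚ
    l<l+1 = subst (ℚ._< l ℚ.+ ℚ.1ℚ) (ℚ.+-identityʳ l) (ℚ.+-monoʳ-< l (ℚ.positive⁻¹ ℚ.1ℚ))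

  vol/K-lowerBound : ∀ K .{{_ : NonZero K}} → (∀ f → denom G H f ≤ K * numer G H f) →
                     LowerBound G H ((ℤ.+ vol G) ℚ./ K)
  vol/K-lowerBound K denom≤ f = frac-≤ (vol G) K (vol G * numer G H f) (denom G H f)
    (≤-trans (*-monoʳ-≤ (vol G) (denom≤ f))
             (≤-reflexive (solve 3 (λ V K N → V :* (K :* N) := V :* N :* K) refl (vol G) K (numer G H f))))

  vol≤K*λ : ∀ K → (∀ f → denom G H f ≤ K * numer G H f) → ∀ {l} → IsLambda G H l →
            toℚ (vol G) ℚ.≤ toℚ K ℚ.* l
  vol≤K*λ zero denom≤ isλ = contradiction isλ (denom≡0⇒¬IsLambda (λ f → n≤0⇒n≡0 (denom≤ f)))
  vol≤K*λ K@(suc _) denom≤ (_ , greatest) = ℚ.≤-trans vol≤K*[vol/K]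
    (ℚ.*-monoˡ-≤-nonNeg (toℚ K) {{toℚ-nonNeg K}} (greatest _ (vol/K-lowerBound K denom≤)))
    where
    vol≤K*[vol/K] : toℚ (vol G) ℚ.≤ toℚ K ℚ.* ((ℤ.+ vol G) ℚ./ K)
    vol≤K*[vol/K] = subst (toℚ (vol G) ℚ.≤_) (≡.sym (toℚ-*-frac K (vol G) K))
      (frac-≤ (vol G) 1 (K * vol G) K
        (≤-reflexive (solve 2 (λ V K → V :* K := K :* V :* con 1) refl (vol G) K)))

  c*R≤vol : ∀ c f .{{_ : NonZero (denom G H f)}} → c * numer G H f ≤ denom G H f →
            toℚ c ℚ.* R G H f ℚ.≤ toℚ (vol G)
  c*R≤vol c f c*numer≤denom =
    subst (ℚ._≤ toℚ (vol G)) (≡.sym (toℚ-*-frac c (vol G * numer G H f) (denom G H f)))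
      (frac-≤ (c * (vol G * numer G H f)) (denom G H f) (vol G) 1
        (≤-trans (≤-reflexive (solve 3 (λ c V N → c :* (V :* N) :* con 1 := V :* (c :* N)) refl
                                 c (vol G) (numer G H f)))
                 (*-monoʳ-≤ (vol G) c*numer≤denom)))

  0*λ≤vol : ∀ l → toℚ 0 ℚ.* l ℚ.≤ toℚ (vol G)
  0*λ≤vol l = subst (ℚ._≤ toℚ (vol G)) (≡.sym (ℚ.*-zeroˡ l))
                    (ℚ.nonNegative⁻¹ (toℚ (vol G)) {{toℚ-nonNeg (vol G)}})

  c*λ≤vol : ∀ c → (∀ f → c * numer G H f ≤ denom G H f) → (∃ λ f → 0 < denom G H f) →
            ∀ {l} → IsLambda G H l → toℚ c ℚ.* l ℚ.≤ toℚ (vol G)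
  c*λ≤vol c c*numer≤denom (f , denom>0) (lowerBound , _) =
    ℚ.≤-trans (ℚ.*-monoˡ-≤-nonNeg (toℚ c) {{toℚ-nonNeg c}} (lowerBound f {{denom≢0}}))
              (c*R≤vol c f {{denom≢0}} (c*numer≤denom f))
    where
    denom≢0 : NonZero (denom G H f)
    denom≢0 = >-nonZero denom>0

  subsingleton⇒denom≡0 : (∀ (x y : Fin k) → x ≡ y) → ∀ f → denom G H f ≡ 0
  subsingleton⇒denom≡0 all-equal f = trans
    (Σpairs-cong _ (λ _ _ → 0 * 0) λ u v → cong (λ d → d ^ 2 * deg G u * deg G v)
      (trans (cong (dist H (f u)) (all-equal (f v) (f u))) (dist-refl H (f u))))
    (Σpairs-*ˡ {n} 0 λ _ _ → 0)

  edge⇒denom>0 : ∀ (f : Fin n → Fin k) {u w} → T (adj G u w) → f u ≢ f w → 0 < denom G H f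
  edge⇒denom>0 f {u} {w} a fu≢fw = <-≤-trans term>0 (term≤Σpairs F F-sym (adj⇒≢ G a))
    where
    F : Fin n → Fin n → ℕ
    F x y = dist H (f x) (f y) ^ 2 * deg G x * deg G y
    F-sym : ∀ x y → F x y ≡ F y x
    F-sym x y = trans (cong (λ d → d ^ 2 * deg G x * deg G y) (dist-sym H (f x) (f y)))
                      (xy∙z≈xz∙y (dist H (f y) (f x) ^ 2) (deg G x) (deg G y))
    deg>0 : ∀ {x y} → T (adj G x y) → 0 < deg G x
    deg>0 {y = y} a = ≤-trans (b2n-mono {true} λ _ → a) (term≤Σv _ y)
    dist>0 : 0 < dist H (f u) (f w)
    dist>0 = n≢0⇒n>0 (fu≢fw ∘ dist≡0⇒≡ H (f u) (f w))
    term>0 : 0 < F u w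
    term>0 = *-mono-< (*-mono-< (*-mono-< dist>0 (*-mono-< dist>0 z<s)) (deg>0 a)) (deg>0 (subst T (sym G u w) a))

minDeg>0⇒edge : ∀ {n} (G : Graph n) → 0 < minDeg G → ∃₂ λ u w → T (adj G u w)
minDeg>0⇒edge {suc n} G δ>0 with Σv-pos⇒pos-term _ (<-≤-trans δ>0 (minDeg≤deg G fzero))
... | w , a = fzero , w , b2n>0⇒T a

indicator : ∀ {n k} → Fin n → Fin n → Fin (suc (suc k))
indicator u x with x ≟ u
... | yes _ = fzero
... | no _  = fsuc fzero

indicator-separates : ∀ {n k u w} → u ≢ w → indicator {n} {k} u u ≢ indicator u w
indicator-separates {u = u} {w} u≢w with u ≟ u | w ≟ u
... | no u≢u | _       = contradiction refl u≢u
... | _      | yes w≡u = contradiction (≡.sym w≡u) u≢w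
... | yes _  | no _    = λ ()

admissible-map : ∀ {n} k (G : Graph n) (H : Graph k) {l} → IsLambda G H l → 0 < minDeg G →
                 ∃ λ f → 0 < denom G H f
admissible-map zero G H isλ _ =
  contradiction isλ (denom≡0⇒¬IsLambda G H (subsingleton⇒denom≡0 G H λ ()))
admissible-map (suc zero) G H isλ _ =
  contradiction isλ (denom≡0⇒¬IsLambda G H (subsingleton⇒denom≡0 G H λ { fzero fzero → refl }))
admissible-map (suc (suc k)) G H _ δ>0 = separating (minDeg>0⇒edge G δ>0)
  where
  separating : ∃₂ (λ u w → T (adj G u w)) → ∃ λ f → 0 < denom G H f
  separating (u , w , a) =
    indicator u , edge⇒denom>0 G H (indicator u) a (indicator-separates (adj⇒≢ G a))

minDeg²*λ≤vol : ∀ {n k} (G : Graph n) (H : Graph k) {l} → IsLambda G H l →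
                toℚ (minDeg G ^ 2) ℚ.* l ℚ.≤ toℚ (vol G)
minDeg²*λ≤vol {k = k} G H {l} isλ = by-cases (minDeg G ≟ℕ 0)
  where
  by-cases : Dec (minDeg G ≡ 0) → toℚ (minDeg G ^ 2) ℚ.* l ℚ.≤ toℚ (vol G)
  by-cases (yes δ≡0) =
    subst (λ δ → toℚ (δ ^ 2) ℚ.* l ℚ.≤ toℚ (vol G)) (≡.sym δ≡0) (0*λ≤vol G H l)
  by-cases (no δ≢0)  = c*λ≤vol G H (minDeg G ^ 2) (minDeg²*numer≤denom G H)
                                (admissible-map k G H isλ (n≢0⇒n>0 δ≢0)) isλ

vol≤maxDeg²[1+S]*λ : ∀ {n k} (G : Graph n) (H : Graph k) → Connected G → ∀ {l} → IsLambda G H l →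
                     toℚ (vol G) ℚ.≤ toℚ (maxDeg G ^ 2 * (1 + S G)) ℚ.* l
vol≤maxDeg²[1+S]*λ G H connected =
  vol≤K*λ G H (maxDeg G ^ 2 * (1 + S G)) λ f → denom≤maxDeg²[1+S]*numer G H f connected

-- H and H′ need not be connected: the distance of Defs satisfies the triangle inequality for every graph.
theorem5p1 : (n k : ℕ) (G : Graph n) (H H' : Graph k) →
    Connected G → Connected H → Connected H' →
    (l l' : ℚ) → IsLambda G H l → IsLambda G H' l' →
    toℚ (minDeg G ^ 2) ℚ.* l'
      ℚ.≤ toℚ (maxDeg G ^ 2 * (1 + (n C 2 ∸ edges G) * diam G ^ 2)) ℚ.* l
theorem5p1 n k G H H' connected _ _ l l' isλ isλ' =
  ℚ.≤-trans (minDeg²*λ≤vol G H' isλ') (vol≤maxDeg²[1+S]*λ G H connected isλ)
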